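{- Let $(\mathcal R,\exp)$ be an exponential field which is o-minimal (as a structure in the language $(+,\cdot,0,1,\leqslant,\exp)$) and satisfies $\exp(1)=2$. Let $\mathcal M\subseteq\mathcal R$ be a discretely ordered ring such that $(\mathcal M,\exp)$ is an exponential integer part of $(\mathcal R,\exp)$. Then $(\mathcal M^+,\exp|_{M^+})$, with $S(x)$ interpreted as $x+1$, is a model of $\mathsf{IOpen}(\exp)$.
   Context: An exponential field is an ordered field $\mathcal F$ together with a map $\exp\colon F\to F^{>0}$ which is an order-preserving isomorphism from $(F,+)$ onto $(F^{>0},\cdot)$. A structure with a dense linear order is o-minimal if every definable (with parameters) subset of its domain is a finite union of intervals and points. A discretely ordered ring is an ordered (commutative unital) ring in which $1$ is the least positive element; $M^+=\{m\in M:m\geqslant 0\}$. If $\mathcal M\subseteq\mathcal R$ with $\mathcal M$ discretely ordered, $\mathcal M$ is an integer part of $\mathcal R$ if for every $r\in R$ there is $m\in M$ with $m\leqslant r<m+1$; $(\mathcal M,\exp)$ is an exponential integer part of $(\mathcal R,\exp)$ if moreover $\exp(m)\in M^+$ for all $m\in M^+$. The theory $\mathsf{IOpen}(\exp)$ in the language $(0,S,+,\cdot,\leqslant,\exp)$ consists of: (Q1) $Sx\neq 0$; (Q2) $Sx=Sy\to x=y$; (Q3) $x\neq 0\to\exists y\,(x=Sy)$; (Q4) $x+0=x$; (Q5) $x+Sy=S(x+y)$; (Q6) $x\cdot 0=0$; (Q7) $x\cdot Sy=x\cdot y+x$; (Q8) $x\leqslant y\leftrightarrow\exists r\,(r+x=y)$;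 (E1) $\exp(0)=S(0)$; (E2) $\exp(S(x))=\exp(x)+\exp(x)$; and the induction scheme $\big(\varphi(0,\bar y)\wedge\forall x(\varphi(x,\bar y)\to\varphi(S(x),\bar y))\big)\to\forall x\,\varphi(x,\bar y)$ for every quantifier-free formula $\varphi$ of this language. -}

module Defs where

open import Data.Nat using (ℕ; zero; suc)
open import Data.Fin using (Fin; zero; suc)
open import Data.Product using (Σ; ∃; _×_; _,_)
open import Data.Sum using (_⊎_)
open import Data.Empty using (⊥)
open import Data.List using (List)
open import Data.List.Relation.Unary.Any using (Any)
open import Relation.Nullary using (¬_)
open import Relation.Binary.PropositionalEquality using (_≡_; _≢_)

record OrderedField : Set₁ where
  infixl 6 _+_
  infixl 7 _*_
  infix 4 _≤_ _<_
  field
    Carrier : Set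
    0# 1#   : Carrier
    _+_ _*_ : Carrier → Carrier → Carrier
    -_      : Carrier → Carrier
    _≤_     : Carrier → Carrier → Set
    +-assoc     : ∀ x y z → (x + y) + z ≡ x + (y + z)
    +-comm      : ∀ x y → x + y ≡ y + x
    +-identityˡ : ∀ x → 0# + x ≡ x
    -‿inverseˡ  : ∀ x → (- x) + x ≡ 0#
    *-assoc     : ∀ x y z → (x * y) * z ≡ x * (y * z)
    *-comm      : ∀ x y → x * y ≡ y * x
    *-identityˡ : ∀ x → 1# * x ≡ x
    distribˡ    : ∀ x y z → x * (y + z) ≡ x * y + x * z
    0≢1         : 0# ≢ 1#
    *-inverse   : ∀ x → x ≢ 0# → ∃ λ y → x * y ≡ 1#
    ≤-refl      : ∀ x → x ≤ x
    ≤-trans     : ∀ x y z → x ≤ y → y ≤ z → x ≤ z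
    ≤-antisym   : ∀ x y → x ≤ y → y ≤ x → x ≡ y
    ≤-total     : ∀ x y → x ≤ y ⊎ y ≤ x
    +-mono-≤    : ∀ x y z → x ≤ y → x + z ≤ y + z
    *-nonneg    : ∀ x y → 0# ≤ x → 0# ≤ y → 0# ≤ x * y

  _<_ : Carrier → Carrier → Set
  x < y = x ≤ y × x ≢ y

record ExpField : Set₁ where
  field
    F   : OrderedField
  open OrderedField F public
  field
    exp       : Carrier → Carrier
    exp-pos   : ∀ x → 0# < exp x
    exp-hom   : ∀ x y → exp (x + y) ≡ exp x * exp y
    exp-mono  : ∀ x y → x < y → exp x < exp y
    exp-onto  : ∀ y → 0# < y → ∃ λ x → exp x ≡ y

module FirstOrder (R : ExpField) where
  open ExpField R

  data Term (n : ℕ) : Set where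
    var  : Fin n → Term n
    par  : Carrier → Term n
    zero′ one′ : Term n
    _⊕_ _⊗_ : Term n → Term n → Term n
    expt : Term n → Term n

  data Formula : ℕ → Set where
    _≐_ _≼_ : ∀ {n} → Term n → Term n → Formula n
    ⊥′      : ∀ {n} → Formula n
    _∧′_ _∨′_ _⇒′_ : ∀ {n} → Formula n → Formula n → Formula n
    ∀′ ∃′   : ∀ {n} → Formula (suc n) → Formula n

  ext : ∀ {n} {A : Set} → A → (Fin n → A) → Fin (suc n) → A
  ext a ρ zero    = a
  ext a ρ (suc i) = ρ i

  ⟦_⟧t : ∀ {n} → Term n → (Fin n → Carrier) → Carrier
  ⟦ var i ⟧t ρ  = ρ i
  ⟦ par c ⟧t ρ  = c
  ⟦ zero′ ⟧t ρ  = 0#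
  ⟦ one′ ⟧t ρ   = 1#
  ⟦ s ⊕ t ⟧t ρ  = ⟦ s ⟧t ρ + ⟦ t ⟧t ρ
  ⟦ s ⊗ t ⟧t ρ  = ⟦ s ⟧t ρ * ⟦ t ⟧t ρ
  ⟦ expt t ⟧t ρ = exp (⟦ t ⟧t ρ)

  Sat : ∀ {n} → Formula n → (Fin n → Carrier) → Set
  Sat (s ≐ t) ρ  = ⟦ s ⟧t ρ ≡ ⟦ t ⟧t ρ
  Sat (s ≼ t) ρ  = ⟦ s ⟧t ρ ≤ ⟦ t ⟧t ρ
  Sat ⊥′ ρ       = ⊥
  Sat (φ ∧′ ψ) ρ = Sat φ ρ × Sat ψ ρ
  Sat (φ ∨′ ψ) ρ = Sat φ ρ ⊎ Sat ψ ρ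
  Sat (φ ⇒′ ψ) ρ = Sat φ ρ → Sat ψ ρ
  Sat (∀′ φ) ρ   = ∀ x → Sat φ (ext x ρ)
  Sat (∃′ φ) ρ   = ∃ λ x → Sat φ (ext x ρ)

  data Ext : Set where
    -∞ +∞ : Ext
    fin   : Carrier → Ext

  _<ₑ_ : Ext → Carrier → Set
  -∞    <ₑ x = Data.Unit.⊤ where import Data.Unit
  +∞    <ₑ x = ⊥
  fin a <ₑ x = a < x

  _<ᵉ_ : Carrier → Ext → Set
  x <ᵉ -∞    = ⊥
  x <ᵉ +∞    = Data.Unit.⊤ where import Data.Unit
  x <ᵉ fin b = x < b

  data Piece : Set where
    point    : Carrier → Piece
    interval : Ext → Ext → Piece

  _∈ᴾ_ : Carrier → Piece → Set
  x ∈ᴾ point a        = x ≡ a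
  x ∈ᴾ interval lo hi = lo <ₑ x × x <ᵉ hi

  OMinimal : Set
  OMinimal = (φ : Formula 1) → ∃ λ (ps : List Piece) →
    (∀ x → (Sat φ (ext x (λ ())) → Any (x ∈ᴾ_) ps)
         × (Any (x ∈ᴾ_) ps → Sat φ (ext x (λ ()))))

module IntegerParts (R : ExpField) where
  open ExpField R

  record DiscreteSubring (InM : Carrier → Set) : Set where
    field
      M-0   : InM 0#
      M-1   : InM 1#
      M-+   : ∀ x y → InM x → InM y → InM (x + y)
      M-*   : ∀ x y → InM x → InM y → InM (x * y)
      M--   : ∀ x → InM x → InM (- x)
      M-discrete : ∀ m → InM m → 0# < m → 1# ≤ m

  IsIntegerPart : (Carrier → Set) → Set
  IsIntegerPart InM = DiscreteSubring InM ×
    (∀ r → ∃ λ m → InM m × m ≤ r × r < m + 1#)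

  IsExpIntegerPart : (Carrier → Set) → Set
  IsExpIntegerPart InM = IsIntegerPart InM ×
    (∀ m → InM m → 0# ≤ m → InM (exp m))

data ATerm (n : ℕ) : Set where
  var  : Fin n → ATerm n
  zeroᵃ : ATerm n
  Sᵃ    : ATerm n → ATerm n
  _+ᵃ_ _·ᵃ_ : ATerm n → ATerm n → ATerm n
  expᵃ  : ATerm n → ATerm n

data QF (n : ℕ) : Set where
  _=ᵃ_ _≤ᵃ_ : ATerm n → ATerm n → QF n
  ⊥ᵃ        : QF n
  _∧ᵃ_ _∨ᵃ_ _⇒ᵃ_ : QF n → QF n → QF n

-- A structure for this language, given as a subset Dom of an ambient
-- set D with operations on D (the structure is Dom with the restricted
-- operations; '=' is interpreted by ≡ on D).
record AStr : Set₁ where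
  field
    D    : Set
    Dom  : D → Set
    z    : D
    s    : D → D
    add mul : D → D → D
    le   : D → D → Set
    ex   : D → D

module AStrSem (𝔸 : AStr) where
  open AStr 𝔸

  ⟦_⟧ : ∀ {n} → ATerm n → (Fin n → D) → D
  ⟦ var i ⟧ ρ   = ρ i
  ⟦ zeroᵃ ⟧ ρ   = z
  ⟦ Sᵃ t ⟧ ρ    = s (⟦ t ⟧ ρ)
  ⟦ t +ᵃ u ⟧ ρ  = add (⟦ t ⟧ ρ) (⟦ u ⟧ ρ)
  ⟦ t ·ᵃ u ⟧ ρ  = mul (⟦ t ⟧ ρ) (⟦ u ⟧ ρ)
  ⟦ expᵃ t ⟧ ρ  = ex (⟦ t ⟧ ρ)

  SatA : ∀ {n} → QF n → (Fin n → D) → Set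
  SatA (t =ᵃ u) ρ = ⟦ t ⟧ ρ ≡ ⟦ u ⟧ ρ
  SatA (t ≤ᵃ u) ρ = le (⟦ t ⟧ ρ) (⟦ u ⟧ ρ)
  SatA ⊥ᵃ ρ       = ⊥
  SatA (φ ∧ᵃ ψ) ρ = SatA φ ρ × SatA ψ ρ
  SatA (φ ∨ᵃ ψ) ρ = SatA φ ρ ⊎ SatA ψ ρ
  SatA (φ ⇒ᵃ ψ) ρ = SatA φ ρ → SatA ψ ρ

  extA : ∀ {n} → D → (Fin n → D) → Fin (suc n) → D
  extA a ρ zero    = a
  extA a ρ (suc i) = ρ i

record IOpenExpModel (𝔸 : AStr) : Set where
  open AStr 𝔸
  open AStrSem 𝔸
  field
    cl-z   : Dom z
    cl-s   : ∀ x → Dom x → Dom (s x)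
    cl-add : ∀ x y → Dom x → Dom y → Dom (add x y)
    cl-mul : ∀ x y → Dom x → Dom y → Dom (mul x y)
    cl-ex  : ∀ x → Dom x → Dom (ex x)
    Q1 : ∀ x → Dom x → s x ≢ z
    Q2 : ∀ x y → Dom x → Dom y → s x ≡ s y → x ≡ y
    Q3 : ∀ x → Dom x → x ≢ z → ∃ λ y → Dom y × x ≡ s y
    Q4 : ∀ x → Dom x → add x z ≡ x
    Q5 : ∀ x y → Dom x → Dom y → add x (s y) ≡ s (add x y)
    Q6 : ∀ x → Dom x → mul x z ≡ z
    Q7 : ∀ x y → Dom x → Dom y → mul x (s y) ≡ add (mul x y) x
    Q8 : ∀ x y → Dom x → Dom y →
           (le x y → ∃ λ r → Dom r × add r x ≡ y)
         × ((∃ λ r → Dom r × add r x ≡ y) → le x y)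
    E1 : ex z ≡ s z
    E2 : ∀ x → Dom x → ex (s x) ≡ add (ex x) (ex x)
    IndOpen : ∀ {n} (φ : QF (suc n)) (ρ : Fin n → D) → (∀ i → Dom (ρ i)) →
      SatA φ (extA z ρ) →
      (∀ x → Dom x → SatA φ (extA x ρ) → SatA φ (extA (s x) ρ)) →
      ∀ x → Dom x → SatA φ (extA x ρ)


module _ (R : ExpField) where
  open ExpField R
  MPlusStr : (Carrier → Set) → AStr
  MPlusStr InM = record
    { D = Carrier
    ; Dom = λ x → InM x × 0# ≤ x
    ; z = 0#
    ; s = λ x → x + 1#
    ; add = _+_
    ; mul = _*_
    ; le = _≤_
    ; ex = exp
    }

-- Excluded middle (the paper's metatheory is classical)
LEM : Set₁
LEM = (P : Set) → P ⊎ ¬ P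

{-# OPTIONS --safe #-}
-- Open induction reduces to a least number principle: if φ failed somewhere on M⁺, the least
-- counterexample m would be neither 0 (base case) nor a successor k + 1 with k ∈ M⁺ (step case).
-- The failure set of φ is definable in R, so by o-minimality it is a finite union of points and
-- intervals, and each of these has a least element in M⁺ because M is an integer part of R.
-- The arithmetic axioms only use that M is a discretely ordered ring, and E2 is exp (1) = 2.
module Submission where

open import Defs
open import Data.Product using (_×_; _,_; ∃; proj₁; proj₂)
open import Data.Sum using (inj₁; inj₂; [_,_])
open import Data.Empty using (⊥-elim)
open import Data.Unit using (tt)
open import Data.Fin using (Fin; zero; suc)
open import Data.Nat using (ℕ)
open import Data.List using ([]; _∷_)
open import Data.List.Relation.Unary.Any using (Any; toSum; fromSum)
open import Relation.Nullary using (¬_)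
open import Function using (_∘′_)
open import Relation.Unary using (Pred; ∁; _∪_; _∩_; _⊆_; Satisfiable)
open import Level using (0ℓ)
open import Relation.Binary.PropositionalEquality
  using (_≡_; _≢_; refl; sym; trans; cong; cong₂; subst; subst₂; module ≡-Reasoning)

module OrderedFieldProperties (F : OrderedField) where
  open OrderedField F

  infixl 6 _-_
  _-_ : Carrier → Carrier → Carrier
  x - y = x + - y

  +-identityʳ : ∀ x → x + 0# ≡ x
  +-identityʳ x = trans (+-comm x 0#) (+-identityˡ x)

  -‿inverseʳ : ∀ x → x - x ≡ 0#
  -‿inverseʳ x = trans (+-comm x (- x)) (-‿inverseˡ x)

  *-identityʳ : ∀ x → x * 1# ≡ x
  *-identityʳ x = trans (*-comm x 1#) (*-identityˡ x)

  x+y-y≡x : ∀ x y → x + y - y ≡ x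
  x+y-y≡x x y = trans (+-assoc x y (- y)) (trans (cong (x +_) (-‿inverseʳ y)) (+-identityʳ x))

  x-y+y≡x : ∀ x y → x - y + y ≡ x
  x-y+y≡x x y = trans (+-assoc x (- y) y) (trans (cong (x +_) (-‿inverseˡ y)) (+-identityʳ x))

  +-cancelʳ : ∀ x y z → x + z ≡ y + z → x ≡ y
  +-cancelʳ x y z e = trans (sym (x+y-y≡x x z)) (trans (cong (_- z) e) (x+y-y≡x y z))

  *-zeroʳ : ∀ x → x * 0# ≡ 0#
  *-zeroʳ x = +-cancelʳ (x * 0#) 0# (x * 0#) (begin
    x * 0# + x * 0#  ≡⟨ distribˡ x 0# 0# ⟨
    x * (0# + 0#)    ≡⟨ cong (x *_) (+-identityˡ 0#) ⟩
    x * 0#           ≡⟨ +-identityˡ (x * 0#) ⟨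
    0# + x * 0#      ∎)
    where open ≡-Reasoning

  -‿unique : ∀ x y → x + y ≡ 0# → x ≡ - y
  -‿unique x y e = +-cancelʳ x (- y) y (trans e (sym (-‿inverseˡ y)))

  -‿distribˡ-* : ∀ x y → - x * y ≡ - (x * y)
  -‿distribˡ-* x y = -‿unique (- x * y) (x * y) (begin
    - x * y + x * y  ≡⟨ cong₂ _+_ (*-comm (- x) y) (*-comm x y) ⟩
    y * - x + y * x  ≡⟨ distribˡ y (- x) x ⟨
    y * (- x + x)    ≡⟨ cong (y *_) (-‿inverseˡ x) ⟩
    y * 0#           ≡⟨ *-zeroʳ y ⟩
    0#               ∎)
    where open ≡-Reasoning

  -‿involutive : ∀ x → - - x ≡ x
  -‿involutive x = sym (-‿unique x (- x) (-‿inverseʳ x))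

  ≤-<-trans : ∀ x y z → x ≤ y → y < z → x < z
  ≤-<-trans x y z x≤y (y≤z , y≢z) = ≤-trans x y z x≤y y≤z , λ { refl → y≢z (≤-antisym y x y≤z x≤y) }

  <-≤-trans : ∀ x y z → x < y → y ≤ z → x < z
  <-≤-trans x y z (x≤y , x≢y) y≤z = ≤-trans x y z x≤y y≤z , λ { refl → x≢y (≤-antisym x y x≤y y≤z) }

  x≤y⇒0≤y-x : ∀ x y → x ≤ y → 0# ≤ y - x
  x≤y⇒0≤y-x x y x≤y = subst (_≤ y - x) (-‿inverseʳ x) (+-mono-≤ x y (- x) x≤y)

  x<y⇒0<y-x : ∀ x y → x < y → 0# < y - x
  x<y⇒0<y-x x y (x≤y , x≢y) = x≤y⇒0≤y-x x y x≤y , λ e →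
    x≢y (trans (sym (+-identityˡ x)) (trans (cong (_+ x) e) (x-y+y≡x y x)))

  0≤x⇒0<x : ∀ x → 0# ≤ x → x ≢ 0# → 0# < x
  0≤x⇒0<x x 0≤x x≢0 = 0≤x , λ e → x≢0 (sym e)

  -- Otherwise 0 ≤ -1, and then 0 ≤ (-1)·(-1) = 1.
  0≤1 : 0# ≤ 1#
  0≤1 with ≤-total 0# 1#
  ... | inj₁ 0≤1 = 0≤1
  ... | inj₂ 1≤0 = ⊥-elim (0≢1 (≤-antisym 0# 1# (subst (0# ≤_) -1*-1≡1 (*-nonneg _ _ 0≤-1 0≤-1)) 1≤0))
    where
    0≤-1 : 0# ≤ - 1#
    0≤-1 = subst₂ _≤_ (-‿inverseʳ 1#) (+-identityˡ (- 1#)) (+-mono-≤ 1# 0# (- 1#) 1≤0)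
    -1*-1≡1 : - 1# * - 1# ≡ 1#
    -1*-1≡1 = trans (-‿distribˡ-* 1# (- 1#)) (trans (cong -_ (*-identityˡ (- 1#))) (-‿involutive 1#))

  1≰0 : ¬ (1# ≤ 0#)
  1≰0 1≤0 = 0≢1 (≤-antisym 0# 1# 0≤1 1≤0)

  x≤y+x : ∀ x y → 0# ≤ y → x ≤ y + x
  x≤y+x x y 0≤y = subst (_≤ y + x) (+-identityˡ x) (+-mono-≤ 0# y x 0≤y)

  +-nonneg : ∀ x y → 0# ≤ x → 0# ≤ y → 0# ≤ x + y
  +-nonneg x y 0≤x 0≤y = ≤-trans 0# y (x + y) 0≤y (x≤y+x y x 0≤x)

  x+1≰x : ∀ x → ¬ (x + 1# ≤ x)
  x+1≰x x x+1≤x = 1≰0 (subst₂ _≤_ 1+x-x≡1 (-‿inverseʳ x) (+-mono-≤ (x + 1#) x (- x) x+1≤x))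
    where
    1+x-x≡1 : x + 1# - x ≡ 1#
    1+x-x≡1 = trans (cong (_- x) (+-comm x 1#)) (x+y-y≡x 1# x)

  0≤x⇒x+1≢0 : ∀ x → 0# ≤ x → x + 1# ≢ 0#
  0≤x⇒x+1≢0 x 0≤x x+1≡0 = 1≰0 (subst (1# ≤_) x+1≡0 (subst (_≤ x + 1#) (+-identityˡ 1#) (+-mono-≤ 0# x 1# 0≤x)))

module ExpFieldProperties (R : ExpField) where
  open ExpField R
  open OrderedFieldProperties F

  -- exp 0 is a nonzero idempotent.
  exp-0 : exp 0# ≡ 1#
  exp-0 = begin
    exp 0#                  ≡⟨ *-identityʳ (exp 0#) ⟨
    exp 0# * 1#             ≡⟨ cong (exp 0# *_) e*e⁻¹≡1 ⟨
    exp 0# * (exp 0# * e⁻¹) ≡⟨ *-assoc (exp 0#) (exp 0#) e⁻¹ ⟨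
    exp 0# * exp 0# * e⁻¹   ≡⟨ cong (_* e⁻¹) idempotent ⟩
    exp 0# * e⁻¹            ≡⟨ e*e⁻¹≡1 ⟩
    1#                      ∎
    where
    open ≡-Reasoning
    inverse : ∃ λ y → exp 0# * y ≡ 1#
    inverse = *-inverse (exp 0#) (λ e≡0 → proj₂ (exp-pos 0#) (sym e≡0))
    e⁻¹ : Carrier
    e⁻¹ = proj₁ inverse
    e*e⁻¹≡1 : exp 0# * e⁻¹ ≡ 1#
    e*e⁻¹≡1 = proj₂ inverse
    idempotent : exp 0# * exp 0# ≡ exp 0#
    idempotent = trans (sym (exp-hom 0# 0#)) (cong exp (+-identityˡ 0#))

  exp-suc : exp 1# ≡ 1# + 1# → ∀ x → exp (x + 1#) ≡ exp x + exp x
  exp-suc exp1≡2 x = begin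
    exp (x + 1#)            ≡⟨ exp-hom x 1# ⟩
    exp x * exp 1#          ≡⟨ cong (exp x *_) exp1≡2 ⟩
    exp x * (1# + 1#)       ≡⟨ distribˡ (exp x) 1# 1# ⟩
    exp x * 1# + exp x * 1# ≡⟨ cong₂ _+_ (*-identityʳ (exp x)) (*-identityʳ (exp x)) ⟩
    exp x + exp x           ∎
    where open ≡-Reasoning

module DiscreteSubringProperties (R : ExpField) (InM : ExpField.Carrier R → Set)
  (discrete : IntegerParts.DiscreteSubring R InM) where
  open ExpField R
  open OrderedFieldProperties F
  open IntegerParts.DiscreteSubring discrete

  M⁺ : Pred Carrier 0ℓ
  M⁺ x = InM x × 0# ≤ x

  M⁺-0 : M⁺ 0#
  M⁺-0 = M-0 , ≤-refl 0#

  M⁺-+ : ∀ x y → M⁺ x → M⁺ y → M⁺ (x + y)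
  M⁺-+ x y (x∈M , 0≤x) (y∈M , 0≤y) = M-+ x y x∈M y∈M , +-nonneg x y 0≤x 0≤y

  M⁺-* : ∀ x y → M⁺ x → M⁺ y → M⁺ (x * y)
  M⁺-* x y (x∈M , 0≤x) (y∈M , 0≤y) = M-* x y x∈M y∈M , *-nonneg x y 0≤x 0≤y

  M⁺-+1 : ∀ x → M⁺ x → M⁺ (x + 1#)
  M⁺-+1 x x⁺ = M⁺-+ x 1# x⁺ (M-1 , 0≤1)

  <⇒+1≤ : ∀ k m → InM k → InM m → k < m → k + 1# ≤ m
  <⇒+1≤ k m k∈M m∈M k<m = subst₂ _≤_ (+-comm 1# k) (x-y+y≡x m k)
    (+-mono-≤ 1# (m - k) k (M-discrete (m - k) (M-+ m (- k) m∈M (M-- k k∈M)) (x<y⇒0<y-x k m k<m)))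

  ≤⇒M⁺-difference : ∀ x y → InM x → InM y → x ≤ y → ∃ λ r → M⁺ r × r + x ≡ y
  ≤⇒M⁺-difference x y x∈M y∈M x≤y =
    y - x , (M-+ y (- x) y∈M (M-- x x∈M) , x≤y⇒0≤y-x x y x≤y) , x-y+y≡x y x

  M⁺-pred : ∀ m → M⁺ m → m ≢ 0# → M⁺ (m - 1#)
  M⁺-pred m (m∈M , 0≤m) m≢0 =
    M-+ m (- 1#) m∈M (M-- 1# M-1) , x≤y⇒0≤y-x 1# m (M-discrete m m∈M (0≤x⇒0<x m 0≤m m≢0))

module LeastNumberPrinciple (lem : LEM) (R : ExpField) (InM : ExpField.Carrier R → Set)
  (integerPart : IntegerParts.IsIntegerPart R InM) where
  open ExpField R
  open OrderedFieldProperties F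
  open FirstOrder R using (point; interval; -∞; +∞; fin; _∈ᴾ_; _<ᵉ_)
  open IntegerParts.DiscreteSubring (proj₁ integerPart)
  open DiscreteSubringProperties R InM (proj₁ integerPart)

  Least : Pred Carrier 0ℓ → Pred Carrier 0ℓ
  Least S m = (M⁺ ∩ S) m × (M⁺ ∩ S) ⊆ (m ≤_)

  HasLeast : Pred Carrier 0ℓ → Set
  HasLeast S = Satisfiable (M⁺ ∩ S) → ∃ (Least S)

  hasLeast-resp : ∀ {S T} → S ⊆ T → T ⊆ S → HasLeast S → HasLeast T
  hasLeast-resp S⊆T T⊆S hasLeast (m , m⁺ , m∈T) with hasLeast (m , m⁺ , T⊆S m∈T)
  ... | l , (l⁺ , l∈S) , l-least = l , (l⁺ , S⊆T l∈S) , λ (x⁺ , x∈T) → l-least (x⁺ , T⊆S x∈T)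

  least-∪ : ∀ {S T} → ∃ (Least S) → ∃ (Least T) → ∃ (Least (S ∪ T))
  least-∪ (s , (s⁺ , s∈S) , s-least) (t , (t⁺ , t∈T) , t-least) with ≤-total s t
  ... | inj₁ s≤t = s , (s⁺ , inj₁ s∈S) , λ
    { (x⁺ , inj₁ x∈S) → s-least (x⁺ , x∈S)
    ; (x⁺ , inj₂ x∈T) → ≤-trans s t _ s≤t (t-least (x⁺ , x∈T)) }
  ... | inj₂ t≤s = t , (t⁺ , inj₂ t∈T) , λ
    { (x⁺ , inj₁ x∈S) → ≤-trans t s _ t≤s (s-least (x⁺ , x∈S))
    ; (x⁺ , inj₂ x∈T) → t-least (x⁺ , x∈T) }

  least-∪ˡ : ∀ {S T} → ∃ (Least S) → ¬ Satisfiable (M⁺ ∩ T) → ∃ (Least (S ∪ T))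
  least-∪ˡ (s , (s⁺ , s∈S) , s-least) missesT = s , (s⁺ , inj₁ s∈S) , λ
    { (x⁺ , inj₁ x∈S) → s-least (x⁺ , x∈S)
    ; (x⁺ , inj₂ x∈T) → ⊥-elim (missesT (_ , x⁺ , x∈T)) }

  least-∪ʳ : ∀ {S T} → ¬ Satisfiable (M⁺ ∩ S) → ∃ (Least T) → ∃ (Least (S ∪ T))
  least-∪ʳ missesS (t , (t⁺ , t∈T) , t-least) = t , (t⁺ , inj₂ t∈T) , λ
    { (x⁺ , inj₁ x∈S) → ⊥-elim (missesS (_ , x⁺ , x∈S))
    ; (x⁺ , inj₂ x∈T) → t-least (x⁺ , x∈T) }

  hasLeast-∪ : ∀ {S T} → HasLeast S → HasLeast T → HasLeast (S ∪ T)
  hasLeast-∪ {S} {T} hasLeastS hasLeastT (m , m⁺ , m∈S∪T)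
    with lem (Satisfiable (M⁺ ∩ S)) | lem (Satisfiable (M⁺ ∩ T))
  ... | inj₁ meetsS  | inj₁ meetsT  = least-∪ (hasLeastS meetsS) (hasLeastT meetsT)
  ... | inj₁ meetsS  | inj₂ missesT = least-∪ˡ (hasLeastS meetsS) missesT
  ... | inj₂ missesS | inj₁ meetsT  = least-∪ʳ missesS (hasLeastT meetsT)
  ... | inj₂ missesS | inj₂ missesT =
    ⊥-elim ([ (λ m∈S → missesS (m , m⁺ , m∈S)) , (λ m∈T → missesT (m , m⁺ , m∈T)) ] m∈S∪T)

  ≤-<ᵉ-trans : ∀ {x y} hi → x ≤ y → y <ᵉ hi → x <ᵉ hi
  ≤-<ᵉ-trans +∞      x≤y _   = tt
  ≤-<ᵉ-trans (fin b) x≤y y<b = ≤-<-trans _ _ b x≤y y<b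

  -- Above a lower endpoint a, the least element of M⁺ is max(0, ⌊a⌋ + 1).
  hasLeast-piece : ∀ p → HasLeast (_∈ᴾ p)
  hasLeast-piece (point a) (m , m⁺ , refl) = m , (m⁺ , refl) , λ { (_ , refl) → ≤-refl m }
  hasLeast-piece (interval -∞ hi) (m , (_ , 0≤m) , _ , m<hi) =
    0# , (M⁺-0 , tt , ≤-<ᵉ-trans hi 0≤m m<hi) , λ ((_ , 0≤x) , _) → 0≤x
  hasLeast-piece (interval +∞ hi) (_ , _ , () , _)
  hasLeast-piece (interval (fin a) hi) (m , (m∈M , 0≤m) , a<m , m<hi)
    with proj₂ integerPart a
  ... | k , k∈M , k≤a , a<k+1 with ≤-total 0# (k + 1#)
  ... | inj₁ 0≤k+1 = k + 1# , ((M-+ k 1# k∈M M-1 , 0≤k+1) , a<k+1 , ≤-<ᵉ-trans hi k+1≤m m<hi) ,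
          λ ((x∈M , _) , a<x , _) → <⇒+1≤ k _ k∈M x∈M (≤-<-trans k a _ k≤a a<x)
    where
    k+1≤m : k + 1# ≤ m
    k+1≤m = <⇒+1≤ k m k∈M m∈M (≤-<-trans k a m k≤a a<m)
  ... | inj₂ k+1≤0 = 0# , (M⁺-0 , <-≤-trans a (k + 1#) 0# a<k+1 k+1≤0 , ≤-<ᵉ-trans hi 0≤m m<hi) ,
          λ ((_ , 0≤x) , _) → 0≤x

  hasLeast-pieces : ∀ ps → HasLeast (λ x → Any (x ∈ᴾ_) ps)
  hasLeast-pieces []       (_ , _ , ())
  hasLeast-pieces (p ∷ ps) =
    hasLeast-resp fromSum toSum (hasLeast-∪ (hasLeast-piece p) (hasLeast-pieces ps))

  induction-by-least : (P : Pred Carrier 0ℓ) → HasLeast (∁ P) →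
    P 0# → (∀ x → M⁺ x → P x → P (x + 1#)) → ∀ x → M⁺ x → P x
  induction-by-least P hasLeast base step x x⁺ with lem (P x)
  ... | inj₁ Px = Px
  ... | inj₂ ¬Px with hasLeast (x , x⁺ , ¬Px)
  ... | m , (m⁺ , ¬Pm) , m-least with lem (m ≡ 0#)
  ... | inj₁ refl = ⊥-elim (¬Pm base)
  ... | inj₂ m≢0  = ⊥-elim (¬Pm (subst P (x-y+y≡x m 1#) (step (m - 1#) k⁺ Pk)))
    where
    k⁺ : M⁺ (m - 1#)
    k⁺ = M⁺-pred m m⁺ m≢0
    Pk : P (m - 1#)
    Pk with lem (P (m - 1#))
    ... | inj₁ Pk  = Pk
    ... | inj₂ ¬Pk = ⊥-elim (x+1≰x (m - 1#)
      (subst (_≤ m - 1#) (sym (x-y+y≡x m 1#)) (m-least (k⁺ , ¬Pk))))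

-- Variable 0 of a formula becomes the free variable of a one-variable formula over R,
-- the remaining ones become parameters.
module QuantifierFreeDefinability (R : ExpField) (InM : ExpField.Carrier R → Set) where
  open ExpField R
  open FirstOrder R
  open AStrSem (MPlusStr R InM)

  toTerm : ∀ {n} → (Fin n → Carrier) → ATerm (ℕ.suc n) → Term 1
  toTerm ρ (var zero)    = var zero
  toTerm ρ (var (suc i)) = par (ρ i)
  toTerm ρ zeroᵃ         = zero′
  toTerm ρ (Sᵃ t)        = toTerm ρ t ⊕ one′
  toTerm ρ (t +ᵃ u)      = toTerm ρ t ⊕ toTerm ρ u
  toTerm ρ (t ·ᵃ u)      = toTerm ρ t ⊗ toTerm ρ u
  toTerm ρ (expᵃ t)      = expt (toTerm ρ t)

  toFormula : ∀ {n} → (Fin n → Carrier) → QF (ℕ.suc n) → Formula 1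
  toFormula ρ (t =ᵃ u) = toTerm ρ t ≐ toTerm ρ u
  toFormula ρ (t ≤ᵃ u) = toTerm ρ t ≼ toTerm ρ u
  toFormula ρ ⊥ᵃ       = ⊥′
  toFormula ρ (φ ∧ᵃ ψ) = toFormula ρ φ ∧′ toFormula ρ ψ
  toFormula ρ (φ ∨ᵃ ψ) = toFormula ρ φ ∨′ toFormula ρ ψ
  toFormula ρ (φ ⇒ᵃ ψ) = toFormula ρ φ ⇒′ toFormula ρ ψ

  ⟦toTerm⟧ : ∀ {n} (ρ : Fin n → Carrier) σ t → ⟦ toTerm ρ t ⟧t σ ≡ ⟦ t ⟧ (extA (σ zero) ρ)
  ⟦toTerm⟧ ρ σ (var zero)    = refl
  ⟦toTerm⟧ ρ σ (var (suc i)) = refl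
  ⟦toTerm⟧ ρ σ zeroᵃ         = refl
  ⟦toTerm⟧ ρ σ (Sᵃ t)        = cong (_+ 1#) (⟦toTerm⟧ ρ σ t)
  ⟦toTerm⟧ ρ σ (t +ᵃ u)      = cong₂ _+_ (⟦toTerm⟧ ρ σ t) (⟦toTerm⟧ ρ σ u)
  ⟦toTerm⟧ ρ σ (t ·ᵃ u)      = cong₂ _*_ (⟦toTerm⟧ ρ σ t) (⟦toTerm⟧ ρ σ u)
  ⟦toTerm⟧ ρ σ (expᵃ t)      = cong exp (⟦toTerm⟧ ρ σ t)

  toFormula-sound : ∀ {n} (ρ : Fin n → Carrier) σ φ →
    Sat (toFormula ρ φ) σ → SatA φ (extA (σ zero) ρ)
  toFormula-complete : ∀ {n} (ρ : Fin n → Carrier) σ φ →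
    SatA φ (extA (σ zero) ρ) → Sat (toFormula ρ φ) σ

  toFormula-sound ρ σ (t =ᵃ u) h = trans (sym (⟦toTerm⟧ ρ σ t)) (trans h (⟦toTerm⟧ ρ σ u))
  toFormula-sound ρ σ (t ≤ᵃ u) h = subst₂ _≤_ (⟦toTerm⟧ ρ σ t) (⟦toTerm⟧ ρ σ u) h
  toFormula-sound ρ σ ⊥ᵃ       h = h
  toFormula-sound ρ σ (φ ∧ᵃ ψ) (hφ , hψ) = toFormula-sound ρ σ φ hφ , toFormula-sound ρ σ ψ hψ
  toFormula-sound ρ σ (φ ∨ᵃ ψ) (inj₁ hφ) = inj₁ (toFormula-sound ρ σ φ hφ)
  toFormula-sound ρ σ (φ ∨ᵃ ψ) (inj₂ hψ) = inj₂ (toFormula-sound ρ σ ψ hψ)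
  toFormula-sound ρ σ (φ ⇒ᵃ ψ) h hφ = toFormula-sound ρ σ ψ (h (toFormula-complete ρ σ φ hφ))

  toFormula-complete ρ σ (t =ᵃ u) h = trans (⟦toTerm⟧ ρ σ t) (trans h (sym (⟦toTerm⟧ ρ σ u)))
  toFormula-complete ρ σ (t ≤ᵃ u) h = subst₂ _≤_ (sym (⟦toTerm⟧ ρ σ t)) (sym (⟦toTerm⟧ ρ σ u)) h
  toFormula-complete ρ σ ⊥ᵃ       h = h
  toFormula-complete ρ σ (φ ∧ᵃ ψ) (hφ , hψ) = toFormula-complete ρ σ φ hφ , toFormula-complete ρ σ ψ hψ
  toFormula-complete ρ σ (φ ∨ᵃ ψ) (inj₁ hφ) = inj₁ (toFormula-complete ρ σ φ hφ)
  toFormula-complete ρ σ (φ ∨ᵃ ψ) (inj₂ hψ) = inj₂ (toFormula-complete ρ σ ψ hψ)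
  toFormula-complete ρ σ (φ ⇒ᵃ ψ) h hφ = toFormula-complete ρ σ ψ (h (toFormula-sound ρ σ φ hφ))

module OpenInduction (lem : LEM) (R : ExpField) (omin : FirstOrder.OMinimal R)
  (InM : ExpField.Carrier R → Set) (integerPart : IntegerParts.IsIntegerPart R InM) where
  open ExpField R
  open FirstOrder R using (_⇒′_; ⊥′; ext)
  open AStrSem (MPlusStr R InM)
  open DiscreteSubringProperties R InM (proj₁ integerPart)
  open LeastNumberPrinciple lem R InM integerPart
  open QuantifierFreeDefinability R InM

  qf-failures-hasLeast : ∀ {n} (φ : QF (ℕ.suc n)) ρ → HasLeast (∁ (λ x → SatA φ (extA x ρ)))
  qf-failures-hasLeast φ ρ with omin (toFormula ρ φ ⇒′ ⊥′)
  ... | ps , pieces = hasLeast-resp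
    (λ {x} x∈ps → proj₂ (pieces x) x∈ps ∘′ toFormula-complete ρ (ext x (λ ())) φ)
    (λ {x} ¬φx → proj₁ (pieces x) (¬φx ∘′ toFormula-sound ρ (ext x (λ ())) φ))
    (hasLeast-pieces ps)

  open-induction : ∀ {n} (φ : QF (ℕ.suc n)) ρ → SatA φ (extA 0# ρ) →
    (∀ x → M⁺ x → SatA φ (extA x ρ) → SatA φ (extA (x + 1#) ρ)) →
    ∀ x → M⁺ x → SatA φ (extA x ρ)
  open-induction φ ρ = induction-by-least (λ x → SatA φ (extA x ρ)) (qf-failures-hasLeast φ ρ)

theorem2p2 : LEM → (R : ExpField) → FirstOrder.OMinimal R →
    ExpField.exp R (ExpField.1# R) ≡ ExpField._+_ R (ExpField.1# R) (ExpField.1# R) →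
    (InM : ExpField.Carrier R → Set) → IntegerParts.IsExpIntegerPart R InM →
    IOpenExpModel (MPlusStr R InM)
theorem2p2 lem R omin exp1≡2 InM ((discrete , floor) , exp-closed) = record
  { cl-z    = M⁺-0
  ; cl-s    = M⁺-+1
  ; cl-add  = M⁺-+
  ; cl-mul  = M⁺-*
  ; cl-ex   = λ x (x∈M , 0≤x) → exp-closed x x∈M 0≤x , proj₁ (exp-pos x)
  ; Q1      = λ x (_ , 0≤x) → 0≤x⇒x+1≢0 x 0≤x
  ; Q2      = λ x y _ _ → +-cancelʳ x y 1#
  ; Q3      = λ x x⁺ x≢0 → x - 1# , M⁺-pred x x⁺ x≢0 , sym (x-y+y≡x x 1#)
  ; Q4      = λ x _ → +-identityʳ x
  ; Q5      = λ x y _ _ → sym (+-assoc x y 1#)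
  ; Q6      = λ x _ → *-zeroʳ x
  ; Q7      = λ x y _ _ → trans (distribˡ x y 1#) (cong (x * y +_) (*-identityʳ x))
  ; Q8      = λ x y (x∈M , _) (y∈M , _) →
      ≤⇒M⁺-difference x y x∈M y∈M , λ { (r , (_ , 0≤r) , refl) → x≤y+x x r 0≤r }
  ; E1      = trans exp-0 (sym (+-identityˡ 1#))
  ; E2      = λ x _ → exp-suc exp1≡2 x
  ; IndOpen = λ φ ρ _ → open-induction φ ρ
  }
  where
  open ExpField R
  open OrderedFieldProperties F
  open ExpFieldProperties R
  open DiscreteSubringProperties R InM discrete
  open OpenInduction lem R omin InM (discrete , floor)
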